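{- For every set of formulas $\Gamma\cup\{A\}\subseteq For(\Sigma)$: if $\Gamma\vdash_{LET_K} A$ then $\Gamma\models_{\mathcal{M}_{LET_K}} A$.
   Context: Fix a denumerable set of propositional variables and let $For(\Sigma)$ be the set of formulas over $\Sigma=\{\land,\lor,\to,\neg,\circ\}$. The logic $LET_K$ is given by the natural deduction system with the following rules (derivations defined as usual; bracketed hypotheses are discharged); $\Gamma\vdash_{LET_K}A$ means $A$ is derivable from premises in $\Gamma$: ($\land$I) from $A$ and $B$ infer $A\land B$; ($\land$E) from $A\land B$ infer $A$, and infer $B$; ($\lor$I) from $A$ infer $A\lor B$, from $B$ infer $A\lor B$; ($\lor$E) from $A\lor B$, a derivation of $C$ from $[A]$ and a derivation of $C$ from $[B]$, infer $C$; ($\neg\land$I) from $\neg A$ infer $\neg(A\land B)$, from $\neg B$ infer $\neg(A\land B)$; ($\neg\land$E) from $\neg(A\land B)$, a derivation of $C$ from $[\neg A]$ and one of $C$ from $[\neg B]$, infer $C$; ($\neg\lor$I) from $\neg A$ and $\neg B$ infer $\neg(A\lor B)$; ($\neg\lor$E) from $\neg(A\lor B)$ infer $\neg A$, and infer $\neg B$; (DN) from $A$ infer $\neg\neg A$, and from $\neg\neg A$ infer $A$; ($\to$I) from a derivation of $B$ from $[A]$ infer $A\to B$; ($\to$E) from $A\to B$ and $A$ infer $B$; ($\to_{CL}$) axiom $A\lor(A\to B)$; ($\neg\to$I) from $A$ and $\neg B$ infer $\neg(A\to B)$; ($\neg\to$E) from $\neg(A\to B)$ infer $A$, and infer $\neg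 B$; (EXP$^\circ$) from $\circ A$, $A$, $\neg A$ infer $B$; (PEM$^\circ$) from $\circ A$ infer $A\lor\neg A$. Let $\{0,1\}$ be the two-element Boolean algebra with $\sqcap,\sqcup,\sim$ and $a\Rightarrow b=\sim a\sqcup b$. An Nmatrix is a triple $(M,\mathrm{D},\mathcal{O})$ with $\emptyset\ne\mathrm{D}\subseteq M$ and $\mathcal{O}(\#):M^n\to\wp(M)\setminus\{\emptyset\}$ for each $n$-ary connective $\#$; a valuation is a map $v$ with $v(\#(A_1,\dots,A_n))\in\mathcal{O}(\#)(v(A_1),\dots,v(A_n))$; $\Gamma\models A$ iff every valuation mapping all of $\Gamma$ into $\mathrm{D}$ maps $A$ into $\mathrm{D}$. The Nmatrix $\mathcal{M}_{LET_K}$ has domain $B_{LET_K}=\{z\in\{0,1\}^3: z_3\le z_1\sqcup z_2,\ z_1\sqcap z_2\sqcap z_3=0\}=\{T=(1,0,1),T_0=(1,0,0),\mathsf{b}=(1,1,0),\mathsf{n}=(0,0,0),F_0=(0,1,0),F=(0,1,1)\}$, designated set $\mathrm{D}=\{z:z_1=1\}=\{T,T_0,\mathsf{b}\}$, and multioperations ($u$ ranging over $B_{LET_K}$): $z\tilde\land w=\{u:u_1=z_1\sqcap w_1,u_2=z_2\sqcup w_2\}$; $z\tilde\lor w=\{u:u_1=z_1\sqcup w_1,u_2=z_2\sqcap w_2\}$; $z\tilde\to w=\{u:u_1=z_1\Rightarrow w_1,u_2=z_1\sqcap w_2\}$; $\tilde\neg z=\{u:u_1=z_2,u_2=z_1\}$;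 $\tilde\circ z=\{u:u_1=z_3\}$. $\models_{\mathcal{M}_{LET_K}}$ is the induced consequence relation. -}

module Defs where

open import Data.Nat using (ℕ)
open import Data.Bool using (Bool; true; false; _∧_; _∨_; not)
open import Relation.Binary.PropositionalEquality using (_≡_)
open import Data.Product using (_×_)
open import Data.Sum using (_⊎_)

data Formula : Set where
  var  : ℕ → Formula
  _∧'_ : Formula → Formula → Formula
  _∨'_ : Formula → Formula → Formula
  _⇒'_ : Formula → Formula → Formula
  ¬'_  : Formula → Formula
  ∘'_  : Formula → Formula

infixr 26 _∧'_
infixr 25 _∨'_
infixr 24 _⇒'_
infix 30 ¬'_ ∘'_
infixl 3 _,,_

FSet : Set₁
FSet = Formula → Set

_,,_ : FSet → Formula → FSet
(Γ ,, A) B = Γ B ⊎ (B ≡ A)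

infix 2 _⊢_
data _⊢_ (Γ : FSet) : Formula → Set₁ where
  hyp   : ∀ {A} → Γ A → Γ ⊢ A
  ∧I    : ∀ {A B} → Γ ⊢ A → Γ ⊢ B → Γ ⊢ A ∧' B
  ∧E₁   : ∀ {A B} → Γ ⊢ A ∧' B → Γ ⊢ A
  ∧E₂   : ∀ {A B} → Γ ⊢ A ∧' B → Γ ⊢ B
  ∨I₁   : ∀ {A B} → Γ ⊢ A → Γ ⊢ A ∨' B
  ∨I₂   : ∀ {A B} → Γ ⊢ B → Γ ⊢ A ∨' B
  ∨E    : ∀ {A B C} → Γ ⊢ A ∨' B → (Γ ,, A) ⊢ C → (Γ ,, B) ⊢ C → Γ ⊢ C
  ¬∧I₁  : ∀ {A B} → Γ ⊢ ¬' A → Γ ⊢ ¬' (A ∧' B)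
  ¬∧I₂  : ∀ {A B} → Γ ⊢ ¬' B → Γ ⊢ ¬' (A ∧' B)
  ¬∧E   : ∀ {A B C} → Γ ⊢ ¬' (A ∧' B) → (Γ ,, ¬' A) ⊢ C → (Γ ,, ¬' B) ⊢ C → Γ ⊢ C
  ¬∨I   : ∀ {A B} → Γ ⊢ ¬' A → Γ ⊢ ¬' B → Γ ⊢ ¬' (A ∨' B)
  ¬∨E₁  : ∀ {A B} → Γ ⊢ ¬' (A ∨' B) → Γ ⊢ ¬' A
  ¬∨E₂  : ∀ {A B} → Γ ⊢ ¬' (A ∨' B) → Γ ⊢ ¬' B
  DNI   : ∀ {A} → Γ ⊢ A → Γ ⊢ ¬' ¬' A
  DNE   : ∀ {A} → Γ ⊢ ¬' ¬' A → Γ ⊢ A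
  ⇒I    : ∀ {A B} → (Γ ,, A) ⊢ B → Γ ⊢ A ⇒' B
  ⇒E    : ∀ {A B} → Γ ⊢ A ⇒' B → Γ ⊢ A → Γ ⊢ B
  ⇒CL   : ∀ {A B} → Γ ⊢ A ∨' (A ⇒' B)
  ¬⇒I   : ∀ {A B} → Γ ⊢ A → Γ ⊢ ¬' B → Γ ⊢ ¬' (A ⇒' B)
  ¬⇒E₁  : ∀ {A B} → Γ ⊢ ¬' (A ⇒' B) → Γ ⊢ A
  ¬⇒E₂  : ∀ {A B} → Γ ⊢ ¬' (A ⇒' B) → Γ ⊢ ¬' B
  EXP∘  : ∀ {A B} → Γ ⊢ ∘' A → Γ ⊢ A → Γ ⊢ ¬' A → Γ ⊢ B
  PEM∘  : ∀ {A} → Γ ⊢ ∘' A → Γ ⊢ A ∨' ¬' A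

-- The domain B_{LET_K} ⊆ {0,1}^3
data V : Set where
  T T₀ b n F₀ F : V

π₁ π₂ π₃ : V → Bool
π₁ T = true
π₁ T₀ = true
π₁ b = true
π₁ n = false
π₁ F₀ = false
π₁ F = false
π₂ T = false
π₂ T₀ = false
π₂ b = true
π₂ n = false
π₂ F₀ = true
π₂ F = true
π₃ T = true
π₃ T₀ = false
π₃ b = false
π₃ n = false
π₃ F₀ = false
π₃ F = true

Designated : V → Set
Designated z = π₁ z ≡ true

_⇛_ : Bool → Bool → Bool
a ⇛ c = not a ∨ c

-- multioperations as membership predicates u ∈ 𝒪(#)(z, w)
∧∈ : V → V → V → Set
∧∈ z w u = (π₁ u ≡ (π₁ z ∧ π₁ w)) × (π₂ u ≡ (π₂ z ∨ π₂ w))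

∨∈ : V → V → V → Set
∨∈ z w u = (π₁ u ≡ (π₁ z ∨ π₁ w)) × (π₂ u ≡ (π₂ z ∧ π₂ w))

⇒∈ : V → V → V → Set
⇒∈ z w u = (π₁ u ≡ (π₁ z ⇛ π₁ w)) × (π₂ u ≡ (π₁ z ∧ π₂ w))

¬∈ : V → V → Set
¬∈ z u = (π₁ u ≡ π₂ z) × (π₂ u ≡ π₁ z)

∘∈ : V → V → Set
∘∈ z u = π₁ u ≡ π₃ z

record Valuation : Set where
  field
    val  : Formula → V
    v-∧  : ∀ A B → ∧∈ (val A) (val B) (val (A ∧' B))
    v-∨  : ∀ A B → ∨∈ (val A) (val B) (val (A ∨' B))
    v-⇒  : ∀ A B → ⇒∈ (val A) (val B) (val (A ⇒' B))
    v-¬  : ∀ A → ¬∈ (val A) (val (¬' A))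
    v-∘  : ∀ A → ∘∈ (val A) (val (∘' A))

open Valuation public

_⊨_ : FSet → Formula → Set
Γ ⊨ A = (v : Valuation) → (∀ B → Γ B → Designated (val v B)) → Designated (val v A)

-- Through the first two coordinates, a value records whether a formula
-- and its negation are designated, so each introduction and elimination rule
-- (negated or not) reads off a Boolean identity of the corresponding
-- multioperation. The third coordinate is read by ∘, and the two domain
-- constraints z₁ ⊓ z₂ ⊓ z₃ = 0 and z₃ ≤ z₁ ⊔ z₂ are exactly EXP∘ and PEM∘.
module Submission where

open import Defs
open import Data.Bool using (Bool; true; false; _∧_; _∨_)
open import Data.Bool.Properties using (_≟_)
open import Data.Product using (_×_; _,_; proj₁; proj₂)
open import Data.Sum using (_⊎_; inj₁; inj₂; [_,_]; map₂)
open import Data.Empty using (⊥; ⊥-elim)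
open import Function.Bundles using (_⇔_; mk⇔; Equivalence)
open import Function.Construct.Composition using (_⇔-∘_)
open import Relation.Nullary using (yes; no; contradiction)
open import Relation.Binary.PropositionalEquality using (_≡_; refl; sym; trans)

open Equivalence using (to; from)

≡true-cong : ∀ {a c : Bool} → a ≡ c → (a ≡ true) ⇔ (c ≡ true)
≡true-cong e = mk⇔ (trans (sym e)) (trans e)

∧-≡true : ∀ {a c} → (a ∧ c ≡ true) ⇔ (a ≡ true × c ≡ true)
∧-≡true = mk⇔ split (λ { (refl , refl) → refl })
  where
  split : ∀ {a c} → a ∧ c ≡ true → a ≡ true × c ≡ true
  split {true} e = refl , e

∨-≡true : ∀ {a c} → (a ∨ c ≡ true) ⇔ (a ≡ true ⊎ c ≡ true)
∨-≡true = mk⇔ split join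
  where
  split : ∀ {a c} → a ∨ c ≡ true → a ≡ true ⊎ c ≡ true
  split {true}  _ = inj₁ refl
  split {false} e = inj₂ e
  join : ∀ {a c} → a ≡ true ⊎ c ≡ true → a ∨ c ≡ true
  join         (inj₁ refl) = refl
  join {true}  (inj₂ _)    = refl
  join {false} (inj₂ e)    = e

⇛-≡true : ∀ {a c} → (a ⇛ c ≡ true) ⇔ (a ≡ true → c ≡ true)
⇛-≡true = mk⇔ (λ { e refl → e }) implication
  where
  implication : ∀ {a c} → (a ≡ true → c ≡ true) → a ⇛ c ≡ true
  implication {true}  f = f refl
  implication {false} _ = refl

Refuted : V → Set
Refuted z = π₂ z ≡ true

Classical : V → Set
Classical z = π₃ z ≡ true

classical-consistent : ∀ z → Classical z → Designated z → Refuted z → ⊥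
classical-consistent T  _  _  ()
classical-consistent T₀ ()
classical-consistent b  ()
classical-consistent n  ()
classical-consistent F₀ ()
classical-consistent F  _  ()

classical-determined : ∀ z → Classical z → Designated z ⊎ Refuted z
classical-determined T  _ = inj₁ refl
classical-determined F  _ = inj₂ refl
classical-determined T₀ ()
classical-determined b  ()
classical-determined n  ()
classical-determined F₀ ()

module _ (v : Valuation) where

  D R : Formula → Set
  D A = Designated (val v A)
  R A = Refuted (val v A)

  ∧-designated : ∀ A B → D (A ∧' B) ⇔ (D A × D B)
  ∧-designated A B = ∧-≡true ⇔-∘ ≡true-cong (proj₁ (v-∧ v A B))

  ∨-designated : ∀ A B → D (A ∨' B) ⇔ (D A ⊎ D B)
  ∨-designated A B = ∨-≡true ⇔-∘ ≡true-cong (proj₁ (v-∨ v A B))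

  ⇒-designated : ∀ A B → D (A ⇒' B) ⇔ (D A → D B)
  ⇒-designated A B = ⇛-≡true ⇔-∘ ≡true-cong (proj₁ (v-⇒ v A B))

  ¬-designated : ∀ A → D (¬' A) ⇔ R A
  ¬-designated A = ≡true-cong (proj₁ (v-¬ v A))

  ¬-refuted : ∀ A → R (¬' A) ⇔ D A
  ¬-refuted A = ≡true-cong (proj₂ (v-¬ v A))

  ∧-refuted : ∀ A B → R (A ∧' B) ⇔ (R A ⊎ R B)
  ∧-refuted A B = ∨-≡true ⇔-∘ ≡true-cong (proj₂ (v-∧ v A B))

  ∨-refuted : ∀ A B → R (A ∨' B) ⇔ (R A × R B)
  ∨-refuted A B = ∧-≡true ⇔-∘ ≡true-cong (proj₂ (v-∨ v A B))

  ⇒-refuted : ∀ A B → R (A ⇒' B) ⇔ (D A × R B)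
  ⇒-refuted A B = ∧-≡true ⇔-∘ ≡true-cong (proj₂ (v-⇒ v A B))

  ∘-designated : ∀ A → D (∘' A) → Classical (val v A)
  ∘-designated A = trans (sym (v-∘ v A))

  Satisfies : FSet → Set
  Satisfies Γ = ∀ B → Γ B → D B

  satisfies-,, : ∀ {Γ A} → Satisfies Γ → D A → Satisfies (Γ ,, A)
  satisfies-,, h d B (inj₁ g)    = h B g
  satisfies-,, h d B (inj₂ refl) = d

  sound : ∀ {Γ A} → Γ ⊢ A → Satisfies Γ → D A
  sound (hyp {A} g) h = h A g
  sound (∧I {A} {B} p q) h = from (∧-designated A B) (sound p h , sound q h)
  sound (∧E₁ {A} {B} p) h = proj₁ (to (∧-designated A B) (sound p h))
  sound (∧E₂ {A} {B} p) h = proj₂ (to (∧-designated A B) (sound p h))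
  sound (∨I₁ {A} {B} p) h = from (∨-designated A B) (inj₁ (sound p h))
  sound (∨I₂ {A} {B} p) h = from (∨-designated A B) (inj₂ (sound p h))
  sound (∨E {A} {B} p q r) h =
    [ (λ d → sound q (satisfies-,, h d)) , (λ d → sound r (satisfies-,, h d)) ]
      (to (∨-designated A B) (sound p h))
  sound (¬∧I₁ {A} {B} p) h =
    from (¬-designated (A ∧' B)) (from (∧-refuted A B) (inj₁ (to (¬-designated A) (sound p h))))
  sound (¬∧I₂ {A} {B} p) h =
    from (¬-designated (A ∧' B)) (from (∧-refuted A B) (inj₂ (to (¬-designated B) (sound p h))))
  sound (¬∧E {A} {B} p q r) h =
    [ (λ d → sound q (satisfies-,, h (from (¬-designated A) d)))
    , (λ d → sound r (satisfies-,, h (from (¬-designated B) d))) ]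
      (to (∧-refuted A B) (to (¬-designated (A ∧' B)) (sound p h)))
  sound (¬∨I {A} {B} p q) h =
    from (¬-designated (A ∨' B))
      (from (∨-refuted A B) (to (¬-designated A) (sound p h) , to (¬-designated B) (sound q h)))
  sound (¬∨E₁ {A} {B} p) h =
    from (¬-designated A) (proj₁ (to (∨-refuted A B) (to (¬-designated (A ∨' B)) (sound p h))))
  sound (¬∨E₂ {A} {B} p) h =
    from (¬-designated B) (proj₂ (to (∨-refuted A B) (to (¬-designated (A ∨' B)) (sound p h))))
  sound (DNI {A} p) h = from (¬-designated (¬' A)) (from (¬-refuted A) (sound p h))
  sound (DNE {A} p) h = to (¬-refuted A) (to (¬-designated (¬' A)) (sound p h))
  sound (⇒I {A} {B} p) h = from (⇒-designated A B) (λ d → sound p (satisfies-,, h d))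
  sound (⇒E {A} {B} p q) h = to (⇒-designated A B) (sound p h) (sound q h)
  sound (⇒CL {A} {B}) h with π₁ (val v A) ≟ true
  ... | yes d  = from (∨-designated A (A ⇒' B)) (inj₁ d)
  ... | no ¬d = from (∨-designated A (A ⇒' B))
                  (inj₂ (from (⇒-designated A B) (λ d → contradiction d ¬d)))
  sound (¬⇒I {A} {B} p q) h =
    from (¬-designated (A ⇒' B)) (from (⇒-refuted A B) (sound p h , to (¬-designated B) (sound q h)))
  sound (¬⇒E₁ {A} {B} p) h = proj₁ (to (⇒-refuted A B) (to (¬-designated (A ⇒' B)) (sound p h)))
  sound (¬⇒E₂ {A} {B} p) h =
    from (¬-designated B) (proj₂ (to (⇒-refuted A B) (to (¬-designated (A ⇒' B)) (sound p h))))
  sound (EXP∘ {A} p q r) h =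
    ⊥-elim (classical-consistent (val v A) (∘-designated A (sound p h))
                                 (sound q h) (to (¬-designated A) (sound r h)))
  sound (PEM∘ {A} p) h =
    from (∨-designated A (¬' A))
      (map₂ (from (¬-designated A)) (classical-determined (val v A) (∘-designated A (sound p h))))

theorem2p15 : (Γ : FSet) (A : Formula) → Γ ⊢ A → Γ ⊨ A
theorem2p15 Γ A d v h = sound v d h
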